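{- Let algorithm \textsf{R} (defined below) be run on a connected undirected graph with vertex set $[n]$, $n\ge 2$. Then after two rounds, every tree of the label forest contains at least two vertices.
   Context: Each edge $e$ has two ends $e.v,e.w$ (edges never change). Each vertex $v$ has a parent $v.p$, initially $v$; $v$ is a root if $v.p=v$. The parent pointers form a forest (the label forest), whose trees are rooted at roots. Vertices are compared as integers. Each operation is performed simultaneously for all edges/vertices using values at the start of the operation. \textsc{parent-connect}: for each edge $e$, let $x=e.v.p$, $y=e.w.p$; send $\min\{x,y\}$ to $\max\{x,y\}$. \textsc{root-update}: for each root $v$, replace $v.p$ by the minimum of $v.p$ and the vertices sent to $v$ in the preceding \textsc{parent-connect}. \textsc{shortcut}: for each vertex $v$, replace $v.p$ by $(v.p).p$. Algorithm \textsf{R}: repeat \{\textsc{parent-connect}; \textsc{root-update}; \textsc{shortcut}\} until no parent changes; iterations are rounds $1,2,\dots$. -}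

module Defs where

open import Data.Nat using (ℕ; zero; suc)
open import Data.Fin using (Fin; toℕ)
open import Data.Fin.Properties using (_≟_; _≤?_)
open import Data.Product using (_×_; _,_; ∃; Σ)
open import Data.List using (List; []; _∷_; foldr)
open import Data.List.Membership.Propositional using (_∈_)
open import Relation.Nullary using (yes; no; ¬_)
open import Relation.Binary.PropositionalEquality using (_≡_)
open import Function using (_∘_)

-- Vertices of a graph on [n] are Fin n, compared by their integer value.
-- A graph is given by its list of edges; an edge (v , w) has ends v and w.
Edge : ℕ → Set
Edge n = Fin n × Fin n

-- Parent-pointer state: v.p = p v.
Parents : ℕ → Set
Parents n = Fin n → Fin n

minF : ∀ {n} → Fin n → Fin n → Fin n
minF x y with x ≤? y
... | yes _ = x
... | no  _ = y

maxF : ∀ {n} → Fin n → Fin n → Fin n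
maxF x y with x ≤? y
... | yes _ = y
... | no  _ = x

isRoot : ∀ {n} → Parents n → Fin n → Set
isRoot p v = p v ≡ v

-- PARENT-CONNECT followed by ROOT-UPDATE: for each root v, v.p becomes the minimum
-- of v.p and all values min{x,y} sent to v (where x = e.v.p, y = e.w.p and
-- max{x,y} = v).
step : ∀ {n} → Parents n → Fin n → Edge n → Fin n → Fin n
step p v (a , b) r with maxF (p a) (p b) ≟ v
... | yes _ = minF (minF (p a) (p b)) r
... | no  _ = r

minSentTo : ∀ {n} → List (Edge n) → Parents n → Fin n → Fin n → Fin n
minSentTo es p v acc = foldr (step p v) acc es

connectUpdate : ∀ {n} → List (Edge n) → Parents n → Parents n
connectUpdate es p v with p v ≟ v
... | yes _ = minSentTo es p v (p v)
... | no  _ = p v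

shortcut : ∀ {n} → Parents n → Parents n
shortcut p v = p (p v)

round : ∀ {n} → List (Edge n) → Parents n → Parents n
round es p = shortcut (connectUpdate es p)

initial : ∀ {n} → Parents n
initial v = v

-- State after k rounds.  (If the algorithm stops earlier because no parent
-- changed, the state is a fixed point of round, so further iteration is harmless.)
afterRounds : ∀ {n} → List (Edge n) → ℕ → Parents n
afterRounds es zero    = initial
afterRounds es (suc k) = round es (afterRounds es k)

iter : ∀ {n} → Parents n → ℕ → Fin n → Fin n
iter p zero    v = v
iter p (suc k) v = p (iter p k v)

inTreeOf : ∀ {n} → Parents n → Fin n → Fin n → Set
inTreeOf p r v = ∃ λ k → iter p k v ≡ r

data Reach {n} (es : List (Edge n)) (u : Fin n) : Fin n → Set where
  here : Reach es u u
  fwd  : ∀ {w x} → Reach es u w → (w , x) ∈ es → Reach es u x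
  bwd  : ∀ {w x} → Reach es u w → (x , w) ∈ es → Reach es u x

Connected : ∀ {n} → List (Edge n) → Set
Connected {n} es = (u v : Fin n) → Reach es u v

module Submission where

-- Labels only ever decrease: PARENT-CONNECT/ROOT-UPDATE lowers the
-- label of a root and leaves other vertices alone, and SHORTCUT replaces v.p by
-- the smaller (v.p).p.  Hence a root r after round 2 was already a root, and was
-- not relabelled, in both rounds.  A root that is not relabelled receives nothing
-- smaller than itself, so every edge r–u has u.p ≥ r whenever r.p = r.
--   Round 1 (all labels are v itself): a neighbour u of r (one exists since the
--   graph is connected and n ≥ 2) therefore satisfies u > r, so r is sent to u,
--   and after the round u.p ≤ r.
--   Round 2: applying the same fact again gives u.p ≥ r, so u.p = r.  Now u is
--   not a root, keeps parent r, and after SHORTCUT still has parent r.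
-- So u ≠ r lies in the tree of r.

open import Defs
open import Data.Nat using (ℕ; zero; suc; s≤s)
import Data.Nat as ℕ
import Data.Nat.Properties as ℕ
open import Data.Fin using (Fin; _≤_; _<_)
import Data.Fin as F
open import Data.Fin.Properties using (_≟_; _≤?_; ≤-refl; ≤-trans; ≤-antisym; ≤∧≢⇒<)
open import Data.List using (List; []; _∷_)
open import Data.List.Relation.Unary.Any using (here; there)
open import Data.List.Membership.Propositional using (_∈_)
open import Data.Sum using (_⊎_; inj₁; inj₂; swap)
open import Data.Product using (Σ; _×_; _,_; proj₁; proj₂)
open import Data.Empty using (⊥-elim)
open import Relation.Nullary using (¬_; yes; no)
open import Function using (_∘_)
open import Relation.Binary.PropositionalEquality using (_≡_; refl; sym; trans; cong; subst; module ≡-Reasoning)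

Adjacent : ∀ {n} → List (Edge n) → Fin n → Fin n → Set
Adjacent es a b = (a , b) ∈ es ⊎ (b , a) ∈ es

Decreasing : ∀ {n} → Parents n → Set
Decreasing p = ∀ v → p v ≤ v

minF≤ˡ : ∀ {n} (x y : Fin n) → minF x y ≤ x
minF≤ˡ x y with x ≤? y
... | yes _   = ≤-refl
... | no  x≰y = ℕ.<⇒≤ (ℕ.≰⇒> x≰y)

minF≤ʳ : ∀ {n} (x y : Fin n) → minF x y ≤ y
minF≤ʳ x y with x ≤? y
... | yes x≤y = x≤y
... | no  _   = ≤-refl

max-min-> : ∀ {n} (x y : Fin n) → y < x → (maxF x y ≡ x) × (minF x y ≡ y)
max-min-> x y y<x with x ≤? y
... | yes x≤y = ⊥-elim (ℕ.<-irrefl refl (ℕ.<-≤-trans y<x x≤y))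
... | no  _   = refl , refl

max-min-< : ∀ {n} (x y : Fin n) → x < y → (maxF x y ≡ y) × (minF x y ≡ x)
max-min-< x y x<y with x ≤? y
... | yes _   = refl , refl
... | no  x≰y = ⊥-elim (x≰y (ℕ.<⇒≤ x<y))

step≤ : ∀ {n} (p : Parents n) v e r → step p v e r ≤ r
step≤ p v (a , b) r with maxF (p a) (p b) ≟ v
... | yes _ = minF≤ʳ (minF (p a) (p b)) r
... | no  _ = ≤-refl

minSentTo≤acc : ∀ {n} es (p : Parents n) v acc → minSentTo es p v acc ≤ acc
minSentTo≤acc []       p v acc = ≤-refl
minSentTo≤acc (e ∷ es) p v acc = ≤-trans (step≤ p v e _) (minSentTo≤acc es p v acc)

minSentTo≤sent : ∀ {n} es (p : Parents n) v acc a b → (a , b) ∈ es → maxF (p a) (p b) ≡ v →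
                 minSentTo es p v acc ≤ minF (p a) (p b)
minSentTo≤sent (e ∷ es) p v acc a b (here refl) max≡v with maxF (p a) (p b) ≟ v
... | yes _     = minF≤ˡ (minF (p a) (p b)) _
... | no  max≢v = ⊥-elim (max≢v max≡v)
minSentTo≤sent (e ∷ es) p v acc a b (there ab∈es) max≡v =
  ≤-trans (step≤ p v e _) (minSentTo≤sent es p v acc a b ab∈es max≡v)

connectUpdate≤ : ∀ {n} es (p : Parents n) v → connectUpdate es p v ≤ p v
connectUpdate≤ es p v with p v ≟ v
... | yes _ = minSentTo≤acc es p v (p v)
... | no  _ = ≤-refl

connectUpdate-nonRoot : ∀ {n} es (p : Parents n) v → ¬ isRoot p v → connectUpdate es p v ≡ p v
connectUpdate-nonRoot es p v notRoot with p v ≟ v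
... | yes root = ⊥-elim (notRoot root)
... | no  _    = refl

connectUpdate-receives : ∀ {n} es (p : Parents n) v a b → isRoot p v → Adjacent es a b →
                         p a ≡ v → p b < p a → connectUpdate es p v ≤ p b
connectUpdate-receives es p v a b root adj pa≡v pb<pa with p v ≟ v
... | no notRoot = ⊥-elim (notRoot root)
... | yes _ with adj
...   | inj₁ ab∈es = let max≡ , min≡ = max-min-> (p a) (p b) pb<pa in
        subst (minSentTo es p v (p v) ≤_) min≡
              (minSentTo≤sent es p v (p v) a b ab∈es (trans max≡ pa≡v))
...   | inj₂ ba∈es = let max≡ , min≡ = max-min-< (p b) (p a) pb<pa in
        subst (minSentTo es p v (p v) ≤_) min≡
              (minSentTo≤sent es p v (p v) b a ba∈es (trans max≡ pa≡v))

stableRoot-minimal : ∀ {n} es (p : Parents n) v a b → isRoot p v → connectUpdate es p v ≡ v →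
                     Adjacent es a b → p a ≡ v → v ≤ p b
stableRoot-minimal es p v a b root stable adj pa≡v = ℕ.≮⇒≥ smaller-received
  where
  smaller-received : ¬ p b < v
  smaller-received pb<v = ℕ.<-irrefl refl (ℕ.≤-<-trans
    (subst (_≤ p b) stable
      (connectUpdate-receives es p v a b root adj pa≡v (subst (p b <_) (sym pa≡v) pb<v)))
    pb<v)

connectUpdate-decreasing : ∀ {n} es {p : Parents n} → Decreasing p → Decreasing (connectUpdate es p)
connectUpdate-decreasing es {p} dec v = ≤-trans (connectUpdate≤ es p v) (dec v)

round≤connectUpdate : ∀ {n} es {p : Parents n} → Decreasing p → ∀ v → round es p v ≤ connectUpdate es p v
round≤connectUpdate es dec v = connectUpdate-decreasing es dec _

round-decreasing : ∀ {n} es {p : Parents n} → Decreasing p → Decreasing (round es p)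
round-decreasing es dec v = ≤-trans (round≤connectUpdate es dec v) (connectUpdate-decreasing es dec v)

-- Since labels only decrease, a root after a round was a root before it and was
-- not relabelled during it:  r = c (c r) ≤ c r ≤ p r ≤ r  for c = connectUpdate es p.
root-after-round : ∀ {n} es {p : Parents n} → Decreasing p → ∀ r → isRoot (round es p) r →
                   isRoot p r × connectUpdate es p r ≡ r
root-after-round es {p} dec r root = p-r≡r , c-r≡r
  where
  c : Parents _
  c = connectUpdate es p
  c-r≡r : c r ≡ r
  c-r≡r = ≤-antisym (connectUpdate-decreasing es dec r)
                    (subst (_≤ c r) root (connectUpdate-decreasing es dec (c r)))
  p-r≡r : p r ≡ r
  p-r≡r = ≤-antisym (dec r) (subst (_≤ p r) c-r≡r (connectUpdate≤ es p r))

-- In a connected graph every vertex u that is not the only vertex has a neighbour: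
-- the first step of a walk from u to some x ≠ u that leaves u.
neighbour : ∀ {n} {es : List (Edge n)} {u x} → Reach es u x → ¬ x ≡ u →
            Σ (Fin n) λ w → (¬ w ≡ u) × Adjacent es u w
neighbour here x≢u = ⊥-elim (x≢u refl)
neighbour {u = u} (fwd {w} {x} walk wx∈es) x≢u with w ≟ u
... | yes refl = x , x≢u , inj₁ wx∈es
... | no  w≢u  = neighbour walk w≢u
neighbour {u = u} (bwd {w} {x} walk xw∈es) x≢u with w ≟ u
... | yes refl = x , x≢u , inj₂ xw∈es
... | no  w≢u  = neighbour walk w≢u

anotherVertex : ∀ n → 2 ℕ.≤ n → (r : Fin n) → Σ (Fin n) λ v → ¬ v ≡ r
anotherVertex (suc (suc _)) _ F.zero    = F.suc F.zero , λ ()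
anotherVertex (suc (suc _)) _ (F.suc _) = F.zero , λ ()
anotherVertex (suc zero) (s≤s ()) F.zero

-- Round 1 forces u > r and gives u.p ≤ r;
-- round 2 forbids u.p < r; so u.p = r, and u keeps this parent in round 2.
neighbourOfRoot-child : ∀ {n} (es : List (Edge n)) r u → isRoot (afterRounds es 2) r →
                        ¬ u ≡ r → Adjacent es r u → afterRounds es 2 u ≡ r
neighbourOfRoot-child {n} es r u root₂ u≢r adj = begin
  connectUpdate es p₁ (connectUpdate es p₁ u) ≡⟨ cong (connectUpdate es p₁) (connectUpdate-nonRoot es p₁ u u-notRoot) ⟩
  connectUpdate es p₁ (p₁ u)                  ≡⟨ cong (connectUpdate es p₁) p₁u≡r ⟩
  connectUpdate es p₁ r                       ≡⟨ c₁r≡r ⟩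
  r                                           ∎
  where
  open ≡-Reasoning
  p₁ : Parents n
  p₁ = afterRounds es 1
  dec₀ : Decreasing {n} initial
  dec₀ _ = ≤-refl
  stable₂ : isRoot p₁ r × connectUpdate es p₁ r ≡ r
  stable₂ = root-after-round es (round-decreasing es dec₀) r root₂
  p₁r≡r : isRoot p₁ r
  p₁r≡r = proj₁ stable₂
  c₁r≡r : connectUpdate es p₁ r ≡ r
  c₁r≡r = proj₂ stable₂
  c₀r≡r : connectUpdate es initial r ≡ r
  c₀r≡r = proj₂ (root-after-round es dec₀ r p₁r≡r)
  r<u : r < u
  r<u = ≤∧≢⇒< (stableRoot-minimal es initial r r u refl c₀r≡r adj refl) (u≢r ∘ sym)
  p₁u≤r : p₁ u ≤ r
  p₁u≤r = ≤-trans (round≤connectUpdate es dec₀ u)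
                  (connectUpdate-receives es initial u u r refl (swap adj) refl r<u)
  p₁u≡r : p₁ u ≡ r
  p₁u≡r = ≤-antisym p₁u≤r (stableRoot-minimal es p₁ r r u p₁r≡r c₁r≡r adj p₁r≡r)
  u-notRoot : ¬ isRoot p₁ u
  u-notRoot p₁u≡u = u≢r (trans (sym p₁u≡u) p₁u≡r)

lemma21 : (n : ℕ) → 2 ℕ.≤ n → (es : List (Edge n)) → Connected es →
          (r : Fin n) → isRoot (afterRounds es 2) r →
          Σ (Fin n) (λ v → (¬ v ≡ r) × inTreeOf (afterRounds es 2) r v)
lemma21 n 2≤n es connected r root₂ with anotherVertex n 2≤n r
... | x , x≢r with neighbour (connected r x) x≢r
...   | u , u≢r , adj = u , u≢r , 1 , neighbourOfRoot-child es r u root₂ u≢r adj
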